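{- Let $n$ be a positive integer and let $x$ be a complex number for which all the expressions below are defined. Then \[ \sum_{k=0}^{n}(-1)^k\binom{n}{k}\frac{\binom{2x+k}{k}}{\binom{2x+n+k}{k}} \frac{1+2x+2k}{1+2x+n+k}H_{k}^2(x) =\frac{1}{2n}\frac{\binom{2x+n}{n}}{\binom{x+n}{n}^2}\big\{H_{n-1}-H_{n}(x)\big\}. \]
   Context: For a complex number $z$ and a nonnegative integer $t$, $\binom{z}{t}=\frac{z(z-1)\cdots(z-t+1)}{t!}$ (with $\binom{z}{0}=1$). For complex $x$, $H_0(x)=0$ and $H_m(x)=\sum_{j=1}^m\frac{1}{x+j}$ for $m\ge1$; $H_m=H_m(0)$. $H_k^2(x)$ denotes $(H_k(x))^2$. -}

module Defs where

open import Level using (_⊔_) renaming (suc to lsuc)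
open import Data.Nat as ℕ using (ℕ; zero; suc)
open import Relation.Nullary using (¬_)
open import Algebra.Bundles using (CommutativeRing)

ringFromℕ : ∀ {c ℓ} (R : CommutativeRing c ℓ) → ℕ → CommutativeRing.Carrier R
ringFromℕ R zero    = CommutativeRing.0# R
ringFromℕ R (suc n) = CommutativeRing._+_ R (CommutativeRing.1# R) (ringFromℕ R n)

-- A field of characteristic zero (the complex numbers are an instance).
-- The inverse is total; its value at 0 is unconstrained junk and is never
-- used, since the theorem assumes every denominator is nonzero.
record CharZeroField c ℓ : Set (lsuc (c ⊔ ℓ)) where
  field
    commutativeRing : CommutativeRing c ℓ
  open CommutativeRing commutativeRing public
  field
    _⁻¹      : Carrier → Carrier
    inverseʳ : ∀ a → ¬ (a ≈ 0#) → a * (a ⁻¹) ≈ 1#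
    charZero : ∀ n → ¬ (ringFromℕ commutativeRing (suc n) ≈ 0#)
  fromℕ : ℕ → Carrier
  fromℕ = ringFromℕ commutativeRing

module _ {c ℓ} (F : CharZeroField c ℓ) where
  open CharZeroField F

  infixl 7 _÷_
  _÷_ : Carrier → Carrier → Carrier
  a ÷ b = a * (b ⁻¹)

  sgn : ℕ → Carrier
  sgn zero    = 1#
  sgn (suc k) = - sgn k

  fact : ℕ → Carrier
  fact zero    = 1#
  fact (suc t) = fromℕ (suc t) * fact t

  falling : Carrier → ℕ → Carrier
  falling z zero    = 1#
  falling z (suc t) = falling z t * (z - fromℕ t)

  binom : Carrier → ℕ → Carrier
  binom z t = falling z t ÷ fact t

  H : ℕ → Carrier → Carrier
  H zero    x = 0#
  H (suc m) x = H m x + (x + fromℕ (suc m)) ⁻¹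

  sumTo : ℕ → (ℕ → Carrier) → Carrier
  sumTo zero    f = f 0
  sumTo (suc n) f = sumTo n f + f (suc n)

-- With y = 2x, multiplying the k-th summand by Q = (y+n+1)(y+n+2)⋯(y+2n+1) clears all
-- denominators except those of H_k(x), leaving weight n k · H_k(x)², and weight n is the
-- backward difference of an explicit hypergeometric term.  Abel summation therefore turns
-- the left-hand side times Q into -(y+2n+1) V (n-1), where
--   V m = Σ_{k≤m} β m k (H_k(x) + H_{k+1}(x)) / (x+k+1)
-- is linear in the harmonic numbers.  Creative telescoping in m (with certificates ζ and η)
-- gives the first-order recurrences
--   V (m+1) (x+m+2) = 2(m+1)(y+2m+3) V m - W m,   W (m+1) (x+m+3) = 2(m+1)(y+2m+5) W m
-- for V and the harmonic-free sum W m = Σ_{k≤m} ζ m k (1/(x+k+1) + 1/(x+k+2)).  Solving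
-- them gives W m and 2 V m ((x+1)⋯(x+m+1))² in closed form, and the latter is the
-- right-hand side times Q.

module Submission where

open import Defs
open import Algebra.Bundles using (CommutativeRing)
open import Data.Nat as ℕ using (ℕ; zero; suc; _≤_; _<_; _∸_)
import Data.Nat.Properties as ℕ
open import Data.Nat.Combinatorics using (_C_)
import Data.Nat.Combinatorics as ℕ
open import Data.Nat.Solver using (module +-*-Solver)
open import Data.Integer as ℤ using (ℤ; +_; -[1+_]; _⊖_; _◃_)
import Data.Integer.Properties as ℤ
import Data.Sign as Sign
open import Data.Maybe using (Maybe; just; nothing)
open import Data.Sum using (inj₁; inj₂)
open import Relation.Nullary using (¬_; yes; no)
open import Relation.Binary.PropositionalEquality as ≡ using (_≡_)
import Algebra.Solver.Ring.AlmostCommutativeRing as ACR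
import Algebra.Solver.Ring as RingSolver
import Algebra.Properties.Ring as RingProperties

C-absorption : ∀ m k → suc k ℕ.* (suc m C suc k) ≡ suc m ℕ.* (m C k)
C-absorption zero    zero    = ≡.refl
C-absorption zero    (suc k) =
  ≡.trans (≡.cong (suc (suc k) ℕ.*_) (ℕ.k>n⇒nCk≡0 {1} {suc (suc k)} (ℕ.s≤s (ℕ.s≤s ℕ.z≤n))))
          (ℕ.*-zeroʳ (suc (suc k)))
C-absorption (suc m) zero    =
  ≡.trans (ℕ.+-identityʳ _) (≡.trans (ℕ.nC1≡n (suc (suc m))) (≡.sym (ℕ.*-identityʳ _)))
C-absorption (suc m) (suc k) = begin
  suc (suc k) ℕ.* (suc (suc m) C suc (suc k))
    ≡⟨ ≡.cong (suc (suc k) ℕ.*_) (≡.sym (ℕ.nCk+nC[k+1]≡[n+1]C[k+1] (suc m) (suc k))) ⟩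
  suc (suc k) ℕ.* (suc m C suc k ℕ.+ suc m C suc (suc k))
    ≡⟨ ℕ.*-distribˡ-+ (suc (suc k)) (suc m C suc k) (suc m C suc (suc k)) ⟩
  (suc m C suc k ℕ.+ suc k ℕ.* (suc m C suc k)) ℕ.+ suc (suc k) ℕ.* (suc m C suc (suc k))
    ≡⟨ ≡.cong₂ (λ a b → (suc m C suc k ℕ.+ a) ℕ.+ b) (C-absorption m k) (C-absorption m (suc k)) ⟩
  (suc m C suc k ℕ.+ suc m ℕ.* (m C k)) ℕ.+ suc m ℕ.* (m C suc k)
    ≡⟨ ℕ.+-assoc (suc m C suc k) (suc m ℕ.* (m C k)) (suc m ℕ.* (m C suc k)) ⟩
  suc m C suc k ℕ.+ (suc m ℕ.* (m C k) ℕ.+ suc m ℕ.* (m C suc k))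
    ≡⟨ ≡.cong (suc m C suc k ℕ.+_) (≡.sym (ℕ.*-distribˡ-+ (suc m) (m C k) (m C suc k))) ⟩
  suc m C suc k ℕ.+ suc m ℕ.* (m C k ℕ.+ m C suc k)
    ≡⟨ ≡.cong (λ a → suc m C suc k ℕ.+ suc m ℕ.* a) (ℕ.nCk+nC[k+1]≡[n+1]C[k+1] m k) ⟩
  suc (suc m) ℕ.* (suc m C suc k) ∎
  where open ≡.≡-Reasoning

-- (k + 1) C(m, k + 1) = (m - k) C(m, k), with both sides moved so that no subtraction occurs.
C-ratio : ∀ m k → suc k ℕ.* (m C suc k) ℕ.+ k ℕ.* (m C k) ≡ m ℕ.* (m C k)
C-ratio m k = ℕ.+-cancelˡ-≡ (m C k) _ _ (begin
  m C k ℕ.+ (suc k ℕ.* (m C suc k) ℕ.+ k ℕ.* (m C k))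
    ≡⟨ +-*-Solver.solve 3 (λ k a b → b :+ ((con 1 :+ k) :* a :+ k :* b) := (con 1 :+ k) :* (b :+ a))
         ≡.refl k (m C suc k) (m C k) ⟩
  suc k ℕ.* (m C k ℕ.+ m C suc k)
    ≡⟨ ≡.cong (suc k ℕ.*_) (ℕ.nCk+nC[k+1]≡[n+1]C[k+1] m k) ⟩
  suc k ℕ.* (suc m C suc k)
    ≡⟨ C-absorption m k ⟩
  suc m ℕ.* (m C k) ∎)
  where open ≡.≡-Reasoning
        open +-*-Solver

b+[m+k]+[m∸k]≡b+[m+m] : ∀ b m k → k ℕ.≤ m → b ℕ.+ (m ℕ.+ k) ℕ.+ (m ∸ k) ≡ b ℕ.+ (m ℕ.+ m)
b+[m+k]+[m∸k]≡b+[m+m] b m k k≤m = begin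
  b ℕ.+ (m ℕ.+ k) ℕ.+ (m ∸ k)   ≡⟨ ℕ.+-assoc b (m ℕ.+ k) (m ∸ k) ⟩
  b ℕ.+ (m ℕ.+ k ℕ.+ (m ∸ k))   ≡⟨ ≡.cong (b ℕ.+_) (ℕ.+-assoc m k (m ∸ k)) ⟩
  b ℕ.+ (m ℕ.+ (k ℕ.+ (m ∸ k))) ≡⟨ ≡.cong (λ t → b ℕ.+ (m ℕ.+ t)) (ℕ.m+[n∸m]≡n k≤m) ⟩
  b ℕ.+ (m ℕ.+ m)               ∎
  where open ≡.≡-Reasoning

module RingEmbedding {c ℓ} (R : CommutativeRing c ℓ) where
  open CommutativeRing R
  open import Relation.Binary.Reasoning.Setoid setoid

  fromℕ : ℕ → Carrier
  fromℕ = ringFromℕ R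

  fromℕ-+ : ∀ m n → fromℕ (m ℕ.+ n) ≈ fromℕ m + fromℕ n
  fromℕ-+ zero    n = sym (+-identityˡ _)
  fromℕ-+ (suc m) n = trans (+-congˡ (fromℕ-+ m n)) (sym (+-assoc _ _ _))

  fromℕ-* : ∀ m n → fromℕ (m ℕ.* n) ≈ fromℕ m * fromℕ n
  fromℕ-* zero    n = sym (zeroˡ _)
  fromℕ-* (suc m) n = begin
    fromℕ (n ℕ.+ m ℕ.* n)          ≈⟨ fromℕ-+ n (m ℕ.* n) ⟩
    fromℕ n + fromℕ (m ℕ.* n)      ≈⟨ +-cong (sym (*-identityˡ _)) (fromℕ-* m n) ⟩
    1# * fromℕ n + fromℕ m * fromℕ n ≈⟨ sym (distribʳ _ _ _) ⟩
    (1# + fromℕ m) * fromℕ n       ∎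

  fromℕ-cong : ∀ {m n} → m ≡ n → fromℕ m ≈ fromℕ n
  fromℕ-cong ≡.refl = refl

module IntegerSolver {c ℓ} (R : CommutativeRing c ℓ) where
  open CommutativeRing R
  open RingEmbedding R
  open RingProperties ring using (-‿involutive; -0#≈0#; -1*x≈-x; -‿+-comm)
  open import Algebra.Properties.CommutativeSemigroup *-commutativeSemigroup using (interchange)
  open import Relation.Binary.Reasoning.Setoid setoid

  private
    ⟦_⟧ : ℤ → Carrier
    ⟦ + n ⟧      = fromℕ n
    ⟦ -[1+ n ] ⟧ = - fromℕ (suc n)

    sign : Sign.Sign → Carrier
    sign Sign.+ = 1#
    sign Sign.- = - 1#

    sign-* : ∀ s t → sign (s Sign.* t) ≈ sign s * sign t
    sign-* Sign.+ Sign.+ = sym (*-identityˡ _)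
    sign-* Sign.+ Sign.- = sym (*-identityˡ _)
    sign-* Sign.- Sign.+ = sym (*-identityʳ _)
    sign-* Sign.- Sign.- = sym (trans (-1*x≈-x (- 1#)) (-‿involutive 1#))

    ◃-hom : ∀ s n → ⟦ s ◃ n ⟧ ≈ sign s * fromℕ n
    ◃-hom s       zero    = sym (zeroʳ _)
    ◃-hom Sign.+ (suc n) = sym (*-identityˡ _)
    ◃-hom Sign.- (suc n) = sym (-1*x≈-x _)

    sign-abs : ∀ i → ⟦ i ⟧ ≈ sign (ℤ.sign i) * fromℕ ℤ.∣ i ∣
    sign-abs i = trans (reflexive (≡.cong ⟦_⟧ (≡.sym (ℤ.◃-inverse i)))) (◃-hom (ℤ.sign i) ℤ.∣ i ∣)

    ⊖-hom : ∀ m n → ⟦ m ⊖ n ⟧ ≈ fromℕ m - fromℕ n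
    ⊖-hom zero    zero    = sym (-‿inverseʳ 0#)
    ⊖-hom zero    (suc n) = sym (+-identityˡ _)
    ⊖-hom (suc m) zero    = sym (trans (+-congˡ -0#≈0#) (+-identityʳ _))
    ⊖-hom (suc m) (suc n) = begin
      ⟦ suc m ⊖ suc n ⟧       ≡⟨ ≡.cong ⟦_⟧ (ℤ.[1+m]⊖[1+n]≡m⊖n m n) ⟩
      ⟦ m ⊖ n ⟧               ≈⟨ ⊖-hom m n ⟩
      fromℕ m - fromℕ n       ≈⟨ +-congʳ (sym (+-identityˡ _)) ⟩
      0# + fromℕ m - fromℕ n  ≈⟨ +-congʳ (+-congʳ (sym (-‿inverseʳ 1#))) ⟩
      1# - 1# + fromℕ m - fromℕ n
        ≈⟨ trans (+-assoc _ _ _) (trans (+-assoc _ _ _) (+-congˡ (sym (+-assoc _ _ _)))) ⟩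
      1# + (- 1# + fromℕ m - fromℕ n)
        ≈⟨ +-congˡ (trans (+-congʳ (+-comm _ _)) (+-assoc _ _ _)) ⟩
      1# + (fromℕ m + (- 1# - fromℕ n))
        ≈⟨ trans (sym (+-assoc _ _ _)) (+-congˡ (-‿+-comm 1# (fromℕ n))) ⟩
      (1# + fromℕ m) - (1# + fromℕ n) ∎

    +-hom : ∀ i j → ⟦ i ℤ.+ j ⟧ ≈ ⟦ i ⟧ + ⟦ j ⟧
    +-hom (+ m)    (+ n)    = fromℕ-+ m n
    +-hom (+ m)    -[1+ n ] = ⊖-hom m (suc n)
    +-hom -[1+ m ] (+ n)    = trans (⊖-hom n (suc m)) (+-comm _ _)
    +-hom -[1+ m ] -[1+ n ] = begin
      - fromℕ (suc (suc (m ℕ.+ n)))     ≡⟨ ≡.cong (λ t → - fromℕ (suc t)) (≡.sym (ℕ.+-suc m n)) ⟩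
      - fromℕ (suc m ℕ.+ suc n)         ≈⟨ -‿cong (fromℕ-+ (suc m) (suc n)) ⟩
      - (fromℕ (suc m) + fromℕ (suc n)) ≈⟨ sym (-‿+-comm _ _) ⟩
      - fromℕ (suc m) + - fromℕ (suc n) ∎

    *-hom : ∀ i j → ⟦ i ℤ.* j ⟧ ≈ ⟦ i ⟧ * ⟦ j ⟧
    *-hom i j = begin
      ⟦ i ℤ.* j ⟧
        ≈⟨ ◃-hom (ℤ.sign i Sign.* ℤ.sign j) (ℤ.∣ i ∣ ℕ.* ℤ.∣ j ∣) ⟩
      sign (ℤ.sign i Sign.* ℤ.sign j) * fromℕ (ℤ.∣ i ∣ ℕ.* ℤ.∣ j ∣)
        ≈⟨ *-cong (sign-* (ℤ.sign i) (ℤ.sign j)) (fromℕ-* ℤ.∣ i ∣ ℤ.∣ j ∣) ⟩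
      (sign (ℤ.sign i) * sign (ℤ.sign j)) * (fromℕ ℤ.∣ i ∣ * fromℕ ℤ.∣ j ∣)
        ≈⟨ interchange _ _ _ _ ⟩
      (sign (ℤ.sign i) * fromℕ ℤ.∣ i ∣) * (sign (ℤ.sign j) * fromℕ ℤ.∣ j ∣)
        ≈⟨ sym (*-cong (sign-abs i) (sign-abs j)) ⟩
      ⟦ i ⟧ * ⟦ j ⟧ ∎

    neg-hom : ∀ i → ⟦ ℤ.- i ⟧ ≈ - ⟦ i ⟧
    neg-hom (+ zero)  = sym -0#≈0#
    neg-hom (+ suc n) = refl
    neg-hom -[1+ n ]  = sym (-‿involutive _)

    -- Literals are interpreted by [literal], which sends 1 to 1# rather than to
    -- fromℕ 1 = 1# + 0#, so that solved equations match goals definitionally.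
    natural : ℕ → Carrier
    natural 0               = 0#
    natural 1               = 1#
    natural (suc (suc n))   = fromℕ (suc (suc n))

    natural≈fromℕ : ∀ n → natural n ≈ fromℕ n
    natural≈fromℕ 0           = refl
    natural≈fromℕ 1           = sym (+-identityʳ 1#)
    natural≈fromℕ (suc (suc n)) = refl

    literal : ℤ → Carrier
    literal (+ n)    = natural n
    literal -[1+ n ] = - natural (suc n)

    literal≈⟦⟧ : ∀ i → literal i ≈ ⟦ i ⟧
    literal≈⟦⟧ (+ n)    = natural≈fromℕ n
    literal≈⟦⟧ -[1+ n ] = -‿cong (natural≈fromℕ (suc n))

  private
    ACRing = ACR.fromCommutativeRing R

    morphism : ℤ.+-*-rawRing ACR.-Raw-AlmostCommutative⟶ ACRing
    morphism = record
      { ⟦_⟧    = literal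
      ; +-homo = λ i j → trans (literal≈⟦⟧ (i ℤ.+ j))
                          (trans (+-hom i j) (sym (+-cong (literal≈⟦⟧ i) (literal≈⟦⟧ j))))
      ; *-homo = λ i j → trans (literal≈⟦⟧ (i ℤ.* j))
                          (trans (*-hom i j) (sym (*-cong (literal≈⟦⟧ i) (literal≈⟦⟧ j))))
      ; -‿homo = λ i → trans (literal≈⟦⟧ (ℤ.- i))
                         (trans (neg-hom i) (sym (-‿cong (literal≈⟦⟧ i))))
      ; 0-homo = refl
      ; 1-homo = refl
      }

    coefficient-equality : ∀ i j → Maybe (literal i ≈ literal j)
    coefficient-equality i j with i ℤ.≟ j
    ... | yes ≡.refl = just refl
    ... | no _       = nothing

  open RingSolver ℤ.+-*-rawRing ACRing morphism coefficient-equality public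
    using (solve; _:=_; _:+_; _:*_; _:-_; :-_; con)

  ≈-modulo : ∀ {L R q l r} → l ≈ r → L ≈ R + q * (l - r) → L ≈ R
  ≈-modulo {L} {R} {q} {l} {r} l≈r L≈ = begin
    L               ≈⟨ L≈ ⟩
    R + q * (l - r) ≈⟨ +-congˡ (*-congˡ (trans (+-congʳ l≈r) (-‿inverseʳ r))) ⟩
    R + q * 0#      ≈⟨ +-congˡ (zeroʳ q) ⟩
    R + 0#          ≈⟨ +-identityʳ R ⟩
    R               ∎

module Rising {c ℓ} (R : CommutativeRing c ℓ) where
  open CommutativeRing R
  open RingEmbedding R

  rising : Carrier → ℕ → ℕ → Carrier
  rising z b zero    = 1#
  rising z b (suc j) = (z + fromℕ b) * rising z (suc b) j

  rising-snoc : ∀ z b j → rising z b (suc j) ≈ rising z b j * (z + fromℕ (b ℕ.+ j))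
  rising-snoc z b zero    = trans (*-comm _ _) (*-congˡ (+-congˡ (fromℕ-cong (≡.sym (ℕ.+-identityʳ b)))))
  rising-snoc z b (suc j) = trans (*-congˡ (rising-snoc z (suc b) j))
    (trans (sym (*-assoc _ _ _)) (*-congˡ (+-congˡ (fromℕ-cong (≡.sym (ℕ.+-suc b j))))))

  rising-+ : ∀ z b i j → rising z b (i ℕ.+ j) ≈ rising z b i * rising z (b ℕ.+ i) j
  rising-+ z b zero    j = trans (reflexive (≡.cong (λ t → rising z t j) (≡.sym (ℕ.+-identityʳ b))))
                                 (sym (*-identityˡ _))
  rising-+ z b (suc i) j = trans (*-congˡ (rising-+ z (suc b) i j))
    (trans (sym (*-assoc _ _ _)) (*-congˡ (reflexive (≡.cong (λ t → rising z t j) (≡.sym (ℕ.+-suc b i))))))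

module FieldLemmas {c ℓ} (F : CharZeroField c ℓ) where
  open CharZeroField F
  open IntegerSolver commutativeRing
  open RingEmbedding commutativeRing using (fromℕ-+; fromℕ-cong)
  open Rising commutativeRing
  open import Relation.Binary.Reasoning.Setoid setoid

  inverseˡ : ∀ a → a ≉ 0# → a ⁻¹ * a ≈ 1#
  inverseˡ a a≉0 = trans (*-comm _ _) (inverseʳ a a≉0)

  1≉0 : 1# ≉ 0#
  1≉0 1≈0 = charZero 0 (trans (+-identityʳ 1#) 1≈0)

  *-cancelʳ : ∀ {a b} t → t ≉ 0# → a * t ≈ b * t → a ≈ b
  *-cancelʳ {a} {b} t t≉0 eq = begin
    a                 ≈⟨ sym (*-identityʳ a) ⟩
    a * 1#            ≈⟨ *-congˡ (sym (inverseʳ t t≉0)) ⟩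
    a * (t * t ⁻¹)    ≈⟨ sym (*-assoc _ _ _) ⟩
    a * t * t ⁻¹      ≈⟨ *-congʳ eq ⟩
    b * t * t ⁻¹      ≈⟨ *-assoc _ _ _ ⟩
    b * (t * t ⁻¹)    ≈⟨ *-congˡ (inverseʳ t t≉0) ⟩
    b * 1#            ≈⟨ *-identityʳ b ⟩
    b                 ∎

  *-≉0 : ∀ {a b} → a ≉ 0# → b ≉ 0# → a * b ≉ 0#
  *-≉0 {a} {b} a≉0 b≉0 ab≈0 = b≉0 (*-cancelʳ a a≉0 (trans (*-comm _ _) (trans ab≈0 (sym (zeroˡ a)))))

  ≈0⇒*≈0 : ∀ {a} b → a ≈ 0# → a * b ≈ 0#
  ≈0⇒*≈0 b a≈0 = trans (*-congʳ a≈0) (zeroˡ b)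

  *-difference-≈0 : ∀ {a p q} → a ≉ 0# → a * (p - q) ≈ 0# → p ≈ q
  *-difference-≈0 {a} {p} {q} a≉0 eq = begin
    p               ≈⟨ solve 2 (λ p q → p := (p :- q) :+ q) refl p q ⟩
    (p - q) + q     ≈⟨ +-congʳ (*-cancelʳ a a≉0 (trans (*-comm _ _) (trans eq (sym (zeroˡ a))))) ⟩
    0# + q          ≈⟨ +-identityˡ q ⟩
    q               ∎

  ≉0-resp-≈ : ∀ {a b} → a ≈ b → a ≉ 0# → b ≉ 0#
  ≉0-resp-≈ a≈b a≉0 b≈0 = a≉0 (trans a≈b b≈0)

  ÷-*-cancel : ∀ a {b} → b ≉ 0# → a * b ⁻¹ * b ≈ a
  ÷-*-cancel a {b} b≉0 = trans (*-assoc _ _ _) (trans (*-congˡ (inverseˡ b b≉0)) (*-identityʳ a))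


  *-inverse-sum : ∀ {p q a b} → a ≉ 0# → b ≉ 0# → p * (a + b) ≈ q * a * b → p * (a ⁻¹ + b ⁻¹) ≈ q
  *-inverse-sum {p} {q} {a} {b} a≉0 b≉0 eq = *-cancelʳ (a * b) (*-≉0 a≉0 b≉0) (begin
    p * (a ⁻¹ + b ⁻¹) * (a * b)
      ≈⟨ ≈-modulo (inverseʳ a a≉0) (≈-modulo (inverseʳ b b≉0)
           (solve 5 (λ p a b v w → p :* (v :+ w) :* (a :* b)
                        := p :* (a :+ b) :+ p :* b :* (a :* v :- con (+ 1)) :+ p :* a :* (b :* w :- con (+ 1)))
                  refl p a b (a ⁻¹) (b ⁻¹))) ⟩
    p * (a + b)     ≈⟨ eq ⟩
    q * a * b       ≈⟨ *-assoc q a b ⟩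
    q * (a * b)     ∎)

  fact-≉0 : ∀ k → fact F k ≉ 0#
  fact-≉0 zero    = 1≉0
  fact-≉0 (suc k) = *-≉0 (charZero k) (fact-≉0 k)

  falling-rising : ∀ v b k → falling F (v + fromℕ (b ℕ.+ k)) k ≈ rising v (suc b) k
  falling-rising v b zero    = refl
  falling-rising v b (suc k) = begin
    falling F (v + fromℕ (b ℕ.+ suc k)) k * (v + fromℕ (b ℕ.+ suc k) - fromℕ k)
      ≈⟨ *-cong (reflexive (≡.cong (λ t → falling F (v + fromℕ t) k) (ℕ.+-suc b k)))
                (+-congʳ (+-congˡ (fromℕ-+ b (suc k)))) ⟩
    falling F (v + fromℕ (suc b ℕ.+ k)) k * (v + (fromℕ b + (1# + fromℕ k)) - fromℕ k)
      ≈⟨ *-cong (falling-rising v (suc b) k)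
                (solve 3 (λ v β κ → v :+ (β :+ (con (+ 1) :+ κ)) :- κ := v :+ (con (+ 1) :+ β))
                       refl v (fromℕ b) (fromℕ k)) ⟩
    rising v (2 ℕ.+ b) k * (v + fromℕ (suc b))
      ≈⟨ *-comm _ _ ⟩
    rising v (suc b) (suc k) ∎

  binom-rising : ∀ v b k → binom F (v + fromℕ (b ℕ.+ k)) k * fact F k ≈ rising v (suc b) k
  binom-rising v b k = trans (÷-*-cancel _ (fact-≉0 k)) (falling-rising v b k)

  rising-≉0 : ∀ z b j → (∀ i → i ℕ.< j → z + fromℕ (b ℕ.+ i) ≉ 0#) → rising z b j ≉ 0#
  rising-≉0 z b zero    _      = 1≉0
  rising-≉0 z b (suc j) factor =
    *-≉0 (≉0-resp-≈ (+-congˡ (fromℕ-cong (ℕ.+-identityʳ b))) (factor 0 (ℕ.s≤s ℕ.z≤n)))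
         (rising-≉0 z (suc b) j (λ i i<j → ≉0-resp-≈ (+-congˡ (fromℕ-cong (ℕ.+-suc b i))) (factor (suc i) (ℕ.s≤s i<j))))

module Sums {c ℓ} (F : CharZeroField c ℓ) where
  open CharZeroField F
  open IntegerSolver commutativeRing
  open import Relation.Binary.Reasoning.Setoid setoid

  prev : (ℕ → Carrier) → ℕ → Carrier
  prev f zero    = 0#
  prev f (suc k) = f k

  ∇ : (ℕ → Carrier) → ℕ → Carrier
  ∇ f k = f k - prev f k

  sumTo-cong : ∀ n {f g} → (∀ k → k ℕ.≤ n → f k ≈ g k) → sumTo F n f ≈ sumTo F n g
  sumTo-cong zero    f≈g = f≈g 0 ℕ.z≤n
  sumTo-cong (suc n) f≈g = +-cong (sumTo-cong n (λ k k≤n → f≈g k (ℕ.m≤n⇒m≤1+n k≤n))) (f≈g (suc n) ℕ.≤-refl)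

  sumTo-*ʳ : ∀ n (f : ℕ → Carrier) a → sumTo F n f * a ≈ sumTo F n (λ k → f k * a)
  sumTo-*ʳ zero    f a = refl
  sumTo-*ʳ (suc n) f a = trans (distribʳ a _ _) (+-congʳ (sumTo-*ʳ n f a))

  sumTo-*ˡ : ∀ n a (f : ℕ → Carrier) → a * sumTo F n f ≈ sumTo F n (λ k → a * f k)
  sumTo-*ˡ zero    a f = refl
  sumTo-*ˡ (suc n) a f = trans (distribˡ a _ _) (+-congʳ (sumTo-*ˡ n a f))

  sumTo-linear : ∀ n p q (f g : ℕ → Carrier) →
                 sumTo F n (λ k → p * f k - q * g k) ≈ p * sumTo F n f - q * sumTo F n g
  sumTo-linear zero    p q f g = refl
  sumTo-linear (suc n) p q f g = trans (+-congʳ (sumTo-linear n p q f g))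
    (solve 6 (λ p q F G a b → (p :* F :- q :* G) :+ (p :* a :- q :* b) := p :* (F :+ a) :- q :* (G :+ b))
           refl p q (sumTo F n f) (sumTo F n g) (f (suc n)) (g (suc n)))

  sumTo-∇ : ∀ n (f : ℕ → Carrier) → sumTo F n (∇ f) ≈ f n
  sumTo-∇ zero    f = solve 1 (λ a → a :- con (+ 0) := a) refl (f 0)
  sumTo-∇ (suc n) f = trans (+-congʳ (sumTo-∇ n f)) (solve 2 (λ a b → b :+ (a :- b) := a) refl (f (suc n)) (f n))

  sumTo-extend : ∀ n f → f (suc n) ≈ 0# → sumTo F (suc n) f ≈ sumTo F n f
  sumTo-extend n f fn≈0 = trans (+-congˡ fn≈0) (+-identityʳ _)

  sumTo-by-parts : ∀ n (f g : ℕ → Carrier) → sumTo F (suc n) (λ k → ∇ f k * g k)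
                   ≈ f (suc n) * g (suc n) - sumTo F n (λ k → f k * (g (suc k) - g k))
  sumTo-by-parts zero    f g =
    solve 4 (λ a b p q → (a :- con (+ 0)) :* p :+ (b :- a) :* q := b :* q :- a :* (q :- p))
            refl (f 0) (f 1) (g 0) (g 1)
  sumTo-by-parts (suc n) f g = trans (+-congʳ (sumTo-by-parts n f g))
    (solve 5 (λ a b p q S → (a :* p :- S) :+ (b :- a) :* q := b :* q :- (S :+ a :* (q :- p))) refl
       (f (suc n)) (f (suc (suc n))) (g (suc n)) (g (suc (suc n))) (sumTo F n (λ k → f k * (g (suc k) - g k))))

module Development {ℓ₁ ℓ₂} (F : CharZeroField ℓ₁ ℓ₂) (x : CharZeroField.Carrier F) where
  open CharZeroField F
  open FieldLemmas F
  open Sums F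
  open IntegerSolver commutativeRing
  open RingEmbedding commutativeRing using (fromℕ-+; fromℕ-*; fromℕ-cong)
  open Rising commutativeRing
  open import Relation.Binary.Reasoning.Setoid setoid

  y : Carrier
  y = fromℕ 2 * x

  Y : ℕ → Carrier
  Y j = y + fromℕ j

  rise : ℕ → ℕ → Carrier
  rise = rising y

  d : ℕ → Carrier
  d j = x + fromℕ j

  u : ℕ → Carrier
  u j = d j ⁻¹

  c : ℕ → ℕ → Carrier
  c m k = sgn F k * fromℕ (m C k)

  P : ℕ → Carrier
  P = rising x 1

  Hx : ℕ → Carrier
  Hx k = H F k x

  Y-≡ : ∀ {i j} → i ≡ j → Y i ≈ Y j
  Y-≡ ≡.refl = refl

  Y-+ : ∀ b m k → Y (b ℕ.+ (m ℕ.+ k)) ≈ y + (fromℕ b + (fromℕ m + fromℕ k))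
  Y-+ b m k = +-congˡ (trans (fromℕ-+ b (m ℕ.+ k)) (+-congˡ (fromℕ-+ m k)))

  Y-odd : ∀ k → Y (3 ℕ.+ (k ℕ.+ k)) ≈ d (suc k) + d (2 ℕ.+ k)
  Y-odd k = trans (Y-+ 3 k k)
    (solve 2 (λ x κ → con (+ 2) :* x :+ (con (+ 3) :+ (κ :+ κ))
                       := (x :+ (con (+ 1) :+ κ)) :+ (x :+ (con (+ 1) :+ (con (+ 1) :+ κ)))) refl x (fromℕ k))

  Y-even : ∀ m → Y (4 ℕ.+ (m ℕ.+ m)) ≈ fromℕ 2 * d (2 ℕ.+ m)
  Y-even m = trans (Y-+ 4 m m)
    (solve 2 (λ x μ → con (+ 2) :* x :+ (con (+ 4) :+ (μ :+ μ))
                      := con (+ 2) :* (x :+ (con (+ 1) :+ (con (+ 1) :+ μ)))) refl x (fromℕ m))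

  rise-shift : ∀ b t → rise b t * Y (b ℕ.+ t) ≈ Y b * rise (suc b) t
  rise-shift b t = sym (rising-snoc y b t)

  rise-snoc-offset : ∀ b m k → k ≤ m →
                     rise (b ℕ.+ (m ℕ.+ k)) (suc m ∸ k) ≈ rise (b ℕ.+ (m ℕ.+ k)) (m ∸ k) * Y (b ℕ.+ (m ℕ.+ m))
  rise-snoc-offset b m k k≤m = begin
    rise (b ℕ.+ (m ℕ.+ k)) (suc m ∸ k)   ≡⟨ ≡.cong (rise (b ℕ.+ (m ℕ.+ k))) (ℕ.+-∸-assoc 1 k≤m) ⟩
    rise (b ℕ.+ (m ℕ.+ k)) (suc (m ∸ k)) ≈⟨ rising-snoc y (b ℕ.+ (m ℕ.+ k)) (m ∸ k) ⟩
    rise (b ℕ.+ (m ℕ.+ k)) (m ∸ k) * Y (b ℕ.+ (m ℕ.+ k) ℕ.+ (m ∸ k))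
                                         ≈⟨ *-congˡ (Y-≡ (b+[m+k]+[m∸k]≡b+[m+m] b m k k≤m)) ⟩
    rise (b ℕ.+ (m ℕ.+ k)) (m ∸ k) * Y (b ℕ.+ (m ℕ.+ m)) ∎

  rise-2+ : ∀ b t → rise b (suc (suc t)) ≈ rise b t * Y (b ℕ.+ t) * Y (b ℕ.+ suc t)
  rise-2+ b t = trans (rising-snoc y b (suc t)) (*-congʳ (rising-snoc y b t))

  rise-double : ∀ b m → rise 1 (b ℕ.+ (suc m ℕ.+ suc m))
                        ≈ rise 1 (b ℕ.+ (m ℕ.+ m)) * Y (suc (b ℕ.+ (m ℕ.+ m))) * Y (2 ℕ.+ (b ℕ.+ (m ℕ.+ m)))
  rise-double b m = trans (reflexive (≡.cong (rise 1) e)) (rise-2+ 1 (b ℕ.+ (m ℕ.+ m)))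
    where
    e : b ℕ.+ (suc m ℕ.+ suc m) ≡ 2 ℕ.+ (b ℕ.+ (m ℕ.+ m))
    e = ≡.trans (≡.cong (λ t → b ℕ.+ suc t) (ℕ.+-suc m m))
                (≡.trans (ℕ.+-suc b (suc (m ℕ.+ m))) (≡.cong suc (ℕ.+-suc b (m ℕ.+ m))))

  u-cancel : ∀ j → d j ≉ 0# → ∀ p → p * d j * u j ≈ p
  u-cancel j dj≉0 p = trans (*-assoc _ _ _) (trans (*-congˡ (inverseʳ (d j) dj≉0)) (*-identityʳ p))

  -- Signed binomial coefficients

  c-pascal : ∀ m k → c (suc m) k ≈ c m k - prev (c m) k
  c-pascal m zero    = solve 1 (λ t → t := t :- con (+ 0)) refl (c m 0)
  c-pascal m (suc k) = begin
    sgn F (suc k) * fromℕ (suc m C suc k)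
      ≈⟨ *-congˡ (fromℕ-cong (≡.sym (ℕ.nCk+nC[k+1]≡[n+1]C[k+1] m k))) ⟩
    - sgn F k * fromℕ (m C k ℕ.+ m C suc k)
      ≈⟨ *-congˡ (fromℕ-+ (m C k) (m C suc k)) ⟩
    - sgn F k * (fromℕ (m C k) + fromℕ (m C suc k))
      ≈⟨ solve 3 (λ s p q → (:- s) :* (p :+ q) := (:- s) :* q :- s :* p) refl (sgn F k) _ _ ⟩
    c m (suc k) - c m k ∎

  c-vanishes : ∀ {m k} → m < k → c m k ≈ 0#
  c-vanishes {m} {k} m<k = trans (*-congˡ (fromℕ-cong (ℕ.k>n⇒nCk≡0 m<k))) (zeroʳ _)

  c-top : ∀ m p q → c m (suc m) * p * q ≈ 0#
  c-top m p q = ≈0⇒*≈0 q (≈0⇒*≈0 p (c-vanishes (ℕ.n<1+n m)))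

  c-diagonal : ∀ m → c (suc m) (suc m) ≈ - c m m
  c-diagonal m = trans (c-pascal m (suc m))
    (trans (+-congʳ (c-vanishes (ℕ.n<1+n m))) (+-identityˡ _))

  c-ratio : ∀ m k → fromℕ k * c m k + (fromℕ (suc m) - fromℕ k) * prev (c m) k ≈ 0#
  c-ratio m zero    = solve 2 (λ t μ → con (+ 0) :* t :+ (con (+ 1) :+ μ :- con (+ 0)) :* con (+ 0) := con (+ 0))
                        refl (c m 0) (fromℕ m)
  c-ratio m (suc k) = ≈-modulo ratio
    (solve 5 (λ s κ μ p q → (con (+ 1) :+ κ) :* ((:- s) :* q) :+ ((con (+ 1) :+ μ) :- (con (+ 1) :+ κ)) :* (s :* p)
                              := con (+ 0) :+ (:- s) :* (((con (+ 1) :+ κ) :* q :+ κ :* p) :- μ :* p))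
           refl (sgn F k) (fromℕ k) (fromℕ m) (fromℕ (m C k)) (fromℕ (m C suc k)))
    where
    ratio : fromℕ (suc k) * fromℕ (m C suc k) + fromℕ k * fromℕ (m C k) ≈ fromℕ m * fromℕ (m C k)
    ratio = begin
      fromℕ (suc k) * fromℕ (m C suc k) + fromℕ k * fromℕ (m C k)
        ≈⟨ sym (+-cong (fromℕ-* (suc k) (m C suc k)) (fromℕ-* k (m C k))) ⟩
      fromℕ (suc k ℕ.* (m C suc k)) + fromℕ (k ℕ.* (m C k))
        ≈⟨ sym (fromℕ-+ (suc k ℕ.* (m C suc k)) _) ⟩
      fromℕ (suc k ℕ.* (m C suc k) ℕ.+ k ℕ.* (m C k))
        ≈⟨ fromℕ-cong (C-ratio m k) ⟩
      fromℕ (m ℕ.* (m C k))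
        ≈⟨ fromℕ-* m (m C k) ⟩
      fromℕ m * fromℕ (m C k) ∎

  weight : ℕ → ℕ → Carrier
  weight n k = c n k * rise 1 k * Y (suc (k ℕ.+ k)) * rise (2 ℕ.+ (n ℕ.+ k)) (n ∸ k)

  weight-primitive : ℕ → ℕ → Carrier
  weight-primitive m k = c m k * rise 1 (suc k) * rise (3 ℕ.+ (m ℕ.+ k)) (suc m ∸ k)

  g : ℕ → Carrier
  g k = Hx k + Hx (suc k)

  s : ℕ → Carrier
  s k = u (suc k) + u (2 ℕ.+ k)

  β : ℕ → ℕ → Carrier
  β m k = c m k * rise 1 (suc k) * rise (3 ℕ.+ (m ℕ.+ k)) (m ∸ k)

  ζ : ℕ → ℕ → Carrier
  ζ m k = c m k * rise 1 (2 ℕ.+ k) * rise (4 ℕ.+ (m ℕ.+ k)) (m ∸ k)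

  η : ℕ → ℕ → Carrier
  η m k = c m k * rise 1 (3 ℕ.+ k) * rise (5 ℕ.+ (m ℕ.+ k)) (suc m ∸ k)

  λ′ : ℕ → Carrier
  λ′ m = fromℕ 2 * fromℕ (suc m) * Y (3 ℕ.+ (m ℕ.+ m))

  μ′ : ℕ → Carrier
  μ′ m = fromℕ 2 * fromℕ (suc m) * Y (5 ℕ.+ (m ℕ.+ m))

  V : ℕ → Carrier
  V m = sumTo F m (λ k → β m k * u (suc k) * g k)

  W : ℕ → Carrier
  W m = sumTo F m (λ k → ζ m k * s k)

  Admissible : ℕ → Set ℓ₂
  Admissible n = ∀ j → j < n → d (suc j) ≉ 0#

  admissible-≤ : ∀ {m n} → m ≤ n → Admissible n → Admissible m
  admissible-≤ m≤n adm j j<m = adm j (ℕ.<-≤-trans j<m m≤n)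

  g-step : ∀ k → g (suc k) - g k ≈ s k
  g-step k = solve 3 (λ h v w → (h :+ v) :+ ((h :+ v) :+ w) :- (h :+ (h :+ v)) := v :+ w) refl (Hx k) (u (suc k)) (u (2 ℕ.+ k))

  -- Abel summation

  weight-identity : ∀ m k →
    (c m k - prev (c m) k) * Y (suc (k ℕ.+ k)) ≈ c m k * Y (suc k) - prev (c m) k * Y (2 ℕ.+ (m ℕ.+ k))
  weight-identity m k = begin
    (a - b) * Y (suc (k ℕ.+ k))
      ≈⟨ *-congˡ (+-congˡ (+-congˡ (fromℕ-+ k k))) ⟩
    (a - b) * (y + (1# + (κ + κ)))
      ≈⟨ ≈-modulo (c-ratio m k) (solve 5 (λ a b y μ κ →
           (a :- b) :* (y :+ (con (+ 1) :+ (κ :+ κ)))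
           := a :* (y :+ (con (+ 1) :+ κ)) :- b :* (y :+ (con (+ 2) :+ (μ :+ κ)))
              :+ con (+ 1) :* (κ :* a :+ ((con (+ 1) :+ μ) :- κ) :* b :- con (+ 0)))
           refl a b y μ κ) ⟩
    a * Y (suc k) - b * (y + (fromℕ 2 + (μ + κ)))
      ≈⟨ +-congˡ (-‿cong (*-congˡ (sym (Y-+ 2 m k)))) ⟩
    a * Y (suc k) - b * Y (2 ℕ.+ (m ℕ.+ k)) ∎
    where
    a b μ κ : Carrier
    a = c m k
    b = prev (c m) k
    μ = fromℕ m
    κ = fromℕ k

  weight-telescopes : ∀ m k → k ≤ suc m → weight (suc m) k ≈ ∇ (weight-primitive m) k
  weight-telescopes m k k≤1+m = begin
    weight (suc m) k
      ≈⟨ *-congʳ (*-congʳ (*-congʳ (c-pascal m k))) ⟩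
    (c m k - prev (c m) k) * rise 1 k * Y (suc (k ℕ.+ k)) * R
      ≈⟨ solve 5 (λ a b P Z R → (a :- b) :* P :* Z :* R := (P :* R) :* ((a :- b) :* Z)) refl _ _ _ _ _ ⟩
    G * ((c m k - prev (c m) k) * Y (suc (k ℕ.+ k)))
      ≈⟨ *-congˡ (weight-identity m k) ⟩
    G * (c m k * Y (suc k) - prev (c m) k * Y (2 ℕ.+ (m ℕ.+ k)))
      ≈⟨ solve 6 (λ a b P R S T → (P :* R) :* (a :* S :- b :* T) := a :* (P :* S) :* R :- b :* P :* R :* T)
           refl _ _ _ _ _ _ ⟩
    c m k * (rise 1 k * Y (suc k)) * R - prev (c m) k * rise 1 k * R * Y (2 ℕ.+ (m ℕ.+ k))
      ≈⟨ +-cong (*-congʳ (*-congˡ (sym (rising-snoc y 1 k)))) (-‿cong (sym (previous k k≤1+m))) ⟩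
    ∇ (weight-primitive m) k ∎
    where
    R G : Carrier
    R = rise (3 ℕ.+ (m ℕ.+ k)) (suc m ∸ k)
    G = rise 1 k * R
    previous : ∀ k → k ≤ suc m → prev (weight-primitive m) k
                                 ≈ prev (c m) k * rise 1 k * rise (3 ℕ.+ (m ℕ.+ k)) (suc m ∸ k) * Y (2 ℕ.+ (m ℕ.+ k))
    previous zero    _ = solve 2 (λ P Z → con (+ 0) := con (+ 0) :* con (+ 1) :* P :* Z) refl _ _
    previous (suc j) (ℕ.s≤s j≤m) = begin
      c m j * rise 1 (suc j) * rise (3 ℕ.+ (m ℕ.+ j)) (suc m ∸ j)
        ≈⟨ *-congˡ (reflexive (≡.cong (rise (3 ℕ.+ (m ℕ.+ j))) (ℕ.+-∸-assoc 1 j≤m))) ⟩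
      c m j * rise 1 (suc j) * (Y (3 ℕ.+ (m ℕ.+ j)) * rise (4 ℕ.+ (m ℕ.+ j)) (m ∸ j))
        ≈⟨ solve 4 (λ a P Z R → a :* P :* (Z :* R) := a :* P :* R :* Z) refl _ _ _ _ ⟩
      c m j * rise 1 (suc j) * rise (4 ℕ.+ (m ℕ.+ j)) (m ∸ j) * Y (3 ℕ.+ (m ℕ.+ j))
        ≈⟨ *-cong (*-congˡ (reflexive (≡.cong (λ b → rise b (m ∸ j)) e)))
                  (Y-≡ (≡.cong (2 ℕ.+_) (≡.sym (ℕ.+-suc m j)))) ⟩
      c m j * rise 1 (suc j) * rise (3 ℕ.+ (m ℕ.+ suc j)) (m ∸ j) * Y (2 ℕ.+ (m ℕ.+ suc j)) ∎
      where
      e : 4 ℕ.+ (m ℕ.+ j) ≡ 3 ℕ.+ (m ℕ.+ suc j)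
      e = ≡.cong (3 ℕ.+_) (≡.sym (ℕ.+-suc m j))

  abel-summation : ∀ m → sumTo F (suc m) (λ k → weight (suc m) k * (Hx k * Hx k)) ≈ - (Y (3 ℕ.+ (m ℕ.+ m)) * V m)
  abel-summation m = begin
    sumTo F (suc m) (λ k → weight (suc m) k * (Hx k * Hx k))
      ≈⟨ sumTo-cong (suc m) (λ k k≤ → *-congʳ (weight-telescopes m k k≤)) ⟩
    sumTo F (suc m) (λ k → ∇ (weight-primitive m) k * (Hx k * Hx k))
      ≈⟨ sumTo-by-parts m (weight-primitive m) (λ k → Hx k * Hx k) ⟩
    weight-primitive m (suc m) * (Hx (suc m) * Hx (suc m))
      - sumTo F m (λ k → weight-primitive m k * (Hx (suc k) * Hx (suc k) - Hx k * Hx k))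
      ≈⟨ +-cong (≈0⇒*≈0 _ (c-top m _ _)) (-‿cong (sumTo-cong m term)) ⟩
    0# - sumTo F m (λ k → Y (3 ℕ.+ (m ℕ.+ m)) * (β m k * u (suc k) * g k))
      ≈⟨ trans (+-identityˡ _) (-‿cong (sym (sumTo-*ˡ m _ _))) ⟩
    - (Y (3 ℕ.+ (m ℕ.+ m)) * V m) ∎
    where
    term : ∀ k → k ≤ m → weight-primitive m k * (Hx (suc k) * Hx (suc k) - Hx k * Hx k)
                      ≈ Y (3 ℕ.+ (m ℕ.+ m)) * (β m k * u (suc k) * g k)
    term k k≤m = trans (*-congʳ (*-congˡ (rise-snoc-offset 3 m k k≤m)))
      (solve 6 (λ a P R Z h v → a :* P :* (R :* Z) :* ((h :+ v) :* (h :+ v) :- h :* h)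
                                := Z :* (a :* P :* R :* v :* (h :+ (h :+ v))))
             refl (c m k) _ _ _ (Hx k) (u (suc k)))

  -- The recurrence for V

  -- The polynomial identity holds modulo c-ratio, with cofactor -(3x + 2m + k + 5).
  β-identity : ∀ m k →
    (c m k - prev (c m) k) * Y (4 ℕ.+ (m ℕ.+ m)) * d (2 ℕ.+ m) - fromℕ 2 * fromℕ (suc m) * c m k * Y (3 ℕ.+ (m ℕ.+ k))
    ≈ (c m k * Y (2 ℕ.+ k) - prev (c m) k * Y (3 ℕ.+ (m ℕ.+ k))) * d (suc k)
  β-identity m k = begin
    (a - b) * Y (4 ℕ.+ (m ℕ.+ m)) * d (2 ℕ.+ m) - fromℕ 2 * fromℕ (suc m) * a * Y (3 ℕ.+ (m ℕ.+ k))
      ≈⟨ +-cong (*-congʳ (*-congˡ (Y-+ 4 m m))) (-‿cong (*-congˡ (Y-+ 3 m k))) ⟩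
    (a - b) * (y + (fromℕ 4 + (μ + μ))) * d (2 ℕ.+ m)
      - fromℕ 2 * fromℕ (suc m) * a * (y + (fromℕ 3 + (μ + κ)))
      ≈⟨ ≈-modulo (c-ratio m k) (solve 5 (λ x μ κ a b →
           (a :- b) :* (con (+ 2) :* x :+ (con (+ 4) :+ (μ :+ μ)))
             :* (x :+ (con (+ 1) :+ (con (+ 1) :+ μ)))
           :- con (+ 2) :* (con (+ 1) :+ μ) :* a :* (con (+ 2) :* x :+ (con (+ 3) :+ (μ :+ κ)))
           := (a :* (con (+ 2) :* x :+ (con (+ 1) :+ (con (+ 1) :+ κ)))
               :- b :* (con (+ 2) :* x :+ (con (+ 3) :+ (μ :+ κ))))
              :* (x :+ (con (+ 1) :+ κ))
              :+ (:- (con (+ 3) :* x :+ con (+ 2) :* μ :+ κ :+ con (+ 5)))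
                 :* (κ :* a :+ ((con (+ 1) :+ μ) :- κ) :* b :- con (+ 0)))
           refl x μ κ a b) ⟩
    (a * Y (2 ℕ.+ k) - b * (y + (fromℕ 3 + (μ + κ)))) * d (suc k)
      ≈⟨ *-congʳ (+-congˡ (-‿cong (*-congˡ (sym (Y-+ 3 m k))))) ⟩
    (a * Y (2 ℕ.+ k) - b * Y (3 ℕ.+ (m ℕ.+ k))) * d (suc k) ∎
    where
    a b μ κ : Carrier
    a = c m k
    b = prev (c m) k
    μ = fromℕ m
    κ = fromℕ k

  β-telescopes : ∀ m k → k ≤ suc m → d (suc k) ≉ 0# →
                 (β (suc m) k * d (2 ℕ.+ m) - λ′ m * β m k) * u (suc k) ≈ ∇ (ζ m) k
  β-telescopes m k k≤1+m dk≉0 with ℕ.m≤n⇒m<n∨m≡n k≤1+m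
  ... | inj₁ (ℕ.s≤s k≤m) = begin
    (β (suc m) k * d (2 ℕ.+ m) - λ′ m * β m k) * u (suc k)
      ≈⟨ *-congʳ (+-cong (*-congʳ (*-congˡ (rise-snoc-offset 4 m k k≤m)))
                         (-‿cong (solve 4 (λ p q Z B → p :* q :* Z :* B := p :* q :* (B :* Z)) refl _ _ _ _))) ⟩
    (c (suc m) k * rise 1 (suc k) * (R * Y (4 ℕ.+ (m ℕ.+ m))) * d (2 ℕ.+ m)
       - fromℕ 2 * fromℕ (suc m) * (β m k * Y (3 ℕ.+ (m ℕ.+ m)))) * u (suc k)
      ≈⟨ *-congʳ (+-cong (*-congʳ (*-congʳ (*-congʳ (c-pascal m k)))) (-‿cong (*-congˡ shift))) ⟩
    ((a - b) * rise 1 (suc k) * (R * Y (4 ℕ.+ (m ℕ.+ m))) * d (2 ℕ.+ m)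
       - fromℕ 2 * fromℕ (suc m) * (a * rise 1 (suc k) * (Y (3 ℕ.+ (m ℕ.+ k)) * R))) * u (suc k)
      ≈⟨ *-congʳ (solve 9 (λ a b P R Z D t s T →
           (a :- b) :* P :* (R :* Z) :* D :- t :* s :* (a :* P :* (T :* R))
           := (P :* R) :* ((a :- b) :* Z :* D :- t :* s :* a :* T)) refl a b _ _ _ _ _ _ _) ⟩
    G * ((a - b) * Y (4 ℕ.+ (m ℕ.+ m)) * d (2 ℕ.+ m) - fromℕ 2 * fromℕ (suc m) * a * Y (3 ℕ.+ (m ℕ.+ k))) * u (suc k)
      ≈⟨ *-congʳ (*-congˡ (β-identity m k)) ⟩
    G * ((a * Y (2 ℕ.+ k) - b * Y (3 ℕ.+ (m ℕ.+ k))) * d (suc k)) * u (suc k)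
      ≈⟨ trans (*-congʳ (sym (*-assoc _ _ _))) (u-cancel (suc k) dk≉0 _) ⟩
    G * (a * Y (2 ℕ.+ k) - b * Y (3 ℕ.+ (m ℕ.+ k)))
      ≈⟨ solve 6 (λ P R a b S T → (P :* R) :* (a :* S :- b :* T) := a :* (P :* S) :* R :- b :* P :* R :* T)
           refl (rise 1 (suc k)) R a b (Y (2 ℕ.+ k)) (Y (3 ℕ.+ (m ℕ.+ k))) ⟩
    a * (rise 1 (suc k) * Y (2 ℕ.+ k)) * R - b * rise 1 (suc k) * R * Y (3 ℕ.+ (m ℕ.+ k))
      ≈⟨ +-cong (*-congʳ (*-congˡ (sym (rising-snoc y 1 (suc k))))) (-‿cong (sym (previous k k≤m))) ⟩
    ∇ (ζ m) k ∎
    where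
    a b R G : Carrier
    a = c m k
    b = prev (c m) k
    R = rise (4 ℕ.+ (m ℕ.+ k)) (m ∸ k)
    G = rise 1 (suc k) * R
    shift : β m k * Y (3 ℕ.+ (m ℕ.+ m)) ≈ a * rise 1 (suc k) * (Y (3 ℕ.+ (m ℕ.+ k)) * R)
    shift = trans (*-assoc _ _ _) (*-congˡ (trans (*-congˡ (Y-≡ (≡.sym (b+[m+k]+[m∸k]≡b+[m+m] 3 m k k≤m))))
                                                  (rise-shift (3 ℕ.+ (m ℕ.+ k)) (m ∸ k))))
    previous : ∀ k → k ≤ m → prev (ζ m) k
                             ≈ prev (c m) k * rise 1 (suc k) * rise (4 ℕ.+ (m ℕ.+ k)) (m ∸ k) * Y (3 ℕ.+ (m ℕ.+ k))
    previous zero    _   = solve 3 (λ P R Z → con (+ 0) := con (+ 0) :* P :* R :* Z) refl _ _ _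
    previous (suc j) j<m = begin
      c m j * rise 1 (2 ℕ.+ j) * rise (4 ℕ.+ (m ℕ.+ j)) (m ∸ j)
        ≈⟨ *-congˡ (reflexive (≡.cong (rise (4 ℕ.+ (m ℕ.+ j))) (ℕ.+-∸-assoc 1 j<m))) ⟩
      c m j * rise 1 (2 ℕ.+ j) * (Y (4 ℕ.+ (m ℕ.+ j)) * rise (5 ℕ.+ (m ℕ.+ j)) (m ∸ suc j))
        ≈⟨ solve 4 (λ a P Z R → a :* P :* (Z :* R) := a :* P :* R :* Z) refl _ _ _ _ ⟩
      c m j * rise 1 (2 ℕ.+ j) * rise (5 ℕ.+ (m ℕ.+ j)) (m ∸ suc j) * Y (4 ℕ.+ (m ℕ.+ j))
        ≈⟨ *-cong (*-congˡ (reflexive (≡.cong (λ b → rise b (m ∸ suc j)) (≡.cong (4 ℕ.+_) (≡.sym (ℕ.+-suc m j))))))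
                  (Y-≡ (≡.cong (3 ℕ.+_) (≡.sym (ℕ.+-suc m j)))) ⟩
      c m j * rise 1 (2 ℕ.+ j) * rise (4 ℕ.+ (m ℕ.+ suc j)) (m ∸ suc j) * Y (3 ℕ.+ (m ℕ.+ suc j)) ∎
  ... | inj₂ ≡.refl = begin
    (β (suc m) (suc m) * d (2 ℕ.+ m) - λ′ m * β m (suc m)) * u (suc (suc m))
      ≈⟨ *-congʳ (+-cong (*-congʳ (*-cong (*-congʳ (c-diagonal m)) empty)) (-‿cong (*-congˡ (c-top m _ _)))) ⟩
    (- c m m * A * 1# * d (2 ℕ.+ m) - λ′ m * 0#) * u (2 ℕ.+ m)
      ≈⟨ *-congʳ (solve 4 (λ a P D l → (:- a) :* P :* con (+ 1) :* D :- l :* con (+ 0) := (:- a) :* P :* D) refl _ _ _ _) ⟩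
    - c m m * A * d (2 ℕ.+ m) * u (2 ℕ.+ m)
      ≈⟨ u-cancel (2 ℕ.+ m) dk≉0 _ ⟩
    - c m m * A
      ≈⟨ solve 2 (λ a P → (:- a) :* P := con (+ 0) :- a :* P :* con (+ 1)) refl _ _ ⟩
    0# - c m m * A * 1#
      ≈⟨ sym (+-cong (c-top m _ _) (-‿cong (*-congˡ empty))) ⟩
    ∇ (ζ m) (suc m) ∎
    where
    A : Carrier
    A = rise 1 (2 ℕ.+ m)
    empty : ∀ {b} → rise b (m ∸ m) ≈ 1#
    empty = reflexive (≡.cong (rise _) (ℕ.n∸n≡0 m))

  V-recurrence : ∀ m → Admissible (2 ℕ.+ m) → V (suc m) * d (2 ℕ.+ m) - λ′ m * V m ≈ - W m
  V-recurrence m adm = begin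
    V (suc m) * d (2 ℕ.+ m) - λ′ m * V m
      ≈⟨ +-cong (*-comm _ _) (-‿cong (*-congˡ (sym (sumTo-extend m _ βvanishes)))) ⟩
    d (2 ℕ.+ m) * V (suc m) - λ′ m * sumTo F (suc m) (λ k → β m k * u (suc k) * g k)
      ≈⟨ sym (sumTo-linear (suc m) _ _ _ _) ⟩
    sumTo F (suc m) (λ k → d (2 ℕ.+ m) * (β (suc m) k * u (suc k) * g k) - λ′ m * (β m k * u (suc k) * g k))
      ≈⟨ sumTo-cong (suc m) (λ k k≤ → trans
           (solve 6 (λ D B l b v h → D :* (B :* v :* h) :- l :* (b :* v :* h) := (B :* D :- l :* b) :* v :* h)
                  refl _ _ _ _ _ _)
           (*-congʳ (β-telescopes m k k≤ (adm k (ℕ.s≤s k≤))))) ⟩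
    sumTo F (suc m) (λ k → ∇ (ζ m) k * g k)
      ≈⟨ sumTo-by-parts m (ζ m) g ⟩
    ζ m (suc m) * g (suc m) - sumTo F m (λ k → ζ m k * (g (suc k) - g k))
      ≈⟨ +-cong (≈0⇒*≈0 _ (c-top m _ _)) (-‿cong (sumTo-cong m (λ k _ → *-congˡ (g-step k)))) ⟩
    0# - W m
      ≈⟨ +-identityˡ _ ⟩
    - W m ∎
    where
    βvanishes : β m (suc m) * u (2 ℕ.+ m) * g (suc m) ≈ 0#
    βvanishes = ≈0⇒*≈0 _ (≈0⇒*≈0 _ (c-top m _ _))

  -- The recurrence for W

  -- The polynomial identity holds modulo c-ratio, with cofactor
  -- -2 (3x² + 2xm + 4xk + 11x + k² + 2mk + 8k + 3m + 10).
  ζ-identity : ∀ m k →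
    ((c m k - prev (c m) k) * Y (4 ℕ.+ (m ℕ.+ m)) * d (3 ℕ.+ m) - fromℕ 2 * fromℕ (suc m) * c m k * Y (4 ℕ.+ (m ℕ.+ k)))
      * Y (3 ℕ.+ (k ℕ.+ k))
    ≈ fromℕ 2 * (c m k * Y (3 ℕ.+ k) - prev (c m) k * Y (4 ℕ.+ (m ℕ.+ k))) * d (suc k) * d (2 ℕ.+ k)
  ζ-identity m k = begin
    ((a - b) * Y (4 ℕ.+ (m ℕ.+ m)) * d (3 ℕ.+ m) - fromℕ 2 * fromℕ (suc m) * a * Y (4 ℕ.+ (m ℕ.+ k)))
      * Y (3 ℕ.+ (k ℕ.+ k))
      ≈⟨ *-cong (+-cong (*-congʳ (*-congˡ (Y-+ 4 m m))) (-‿cong (*-congˡ (Y-+ 4 m k)))) (Y-+ 3 k k) ⟩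
    ((a - b) * (y + (fromℕ 4 + (μ + μ))) * d (3 ℕ.+ m)
      - fromℕ 2 * fromℕ (suc m) * a * (y + (fromℕ 4 + (μ + κ))))
      * (y + (fromℕ 3 + (κ + κ)))
      ≈⟨ ≈-modulo (c-ratio m k) (solve 5 (λ x μ κ a b →
           ((a :- b) :* (con (+ 2) :* x :+ (con (+ 4) :+ (μ :+ μ)))
               :* (x :+ (con (+ 1) :+ (con (+ 1) :+ (con (+ 1) :+ μ))))
             :- con (+ 2) :* (con (+ 1) :+ μ) :* a
               :* (con (+ 2) :* x :+ (con (+ 4) :+ (μ :+ κ))))
           :* (con (+ 2) :* x :+ (con (+ 3) :+ (κ :+ κ)))
           := con (+ 2) :* (a :* (con (+ 2) :* x :+ (con (+ 1) :+ (con (+ 1) :+ (con (+ 1) :+ κ))))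
                           :- b :* (con (+ 2) :* x :+ (con (+ 4) :+ (μ :+ κ))))
                :* (x :+ (con (+ 1) :+ κ)) :* (x :+ (con (+ 1) :+ (con (+ 1) :+ κ)))
              :+ (:- (con (+ 2) :* (con (+ 3) :* x :* x :+ con (+ 2) :* x :* μ :+ con (+ 4) :* x :* κ :+ con (+ 11) :* x
                                    :+ κ :* κ :+ con (+ 2) :* μ :* κ :+ con (+ 8) :* κ :+ con (+ 3) :* μ :+ con (+ 10))))
                 :* (κ :* a :+ ((con (+ 1) :+ μ) :- κ) :* b :- con (+ 0)))
           refl x μ κ a b) ⟩
    fromℕ 2 * (a * Y (3 ℕ.+ k) - b * (y + (fromℕ 4 + (μ + κ)))) * d (suc k) * d (2 ℕ.+ k)
      ≈⟨ *-congʳ (*-congʳ (*-congˡ (+-congˡ (-‿cong (*-congˡ (sym (Y-+ 4 m k))))))) ⟩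
    fromℕ 2 * (a * Y (3 ℕ.+ k) - b * Y (4 ℕ.+ (m ℕ.+ k))) * d (suc k) * d (2 ℕ.+ k) ∎
    where
    a b μ κ : Carrier
    a = c m k
    b = prev (c m) k
    μ = fromℕ m
    κ = fromℕ k

  ζ-telescopes : ∀ m k → k ≤ suc m → d (suc k) ≉ 0# → d (2 ℕ.+ k) ≉ 0# →
                 Y (4 ℕ.+ (m ℕ.+ m)) * (ζ (suc m) k * d (3 ℕ.+ m) - μ′ m * ζ m k) * s k ≈ fromℕ 2 * ∇ (η m) k
  ζ-telescopes m k k≤1+m d₁≉0 d₂≉0 with ℕ.m≤n⇒m<n∨m≡n k≤1+m
  ... | inj₁ (ℕ.s≤s k≤m) = begin
    Y₄ * (ζ (suc m) k * d (3 ℕ.+ m) - μ′ m * ζ m k) * s k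
      ≈⟨ *-congʳ (solve 5 (λ Y Z D t w → Y :* (Z :* D :- t :* w) := Z :* Y :* D :- (t :* (w :* Y)))
                   refl Y₄ _ _ _ _) ⟩
    (ζ (suc m) k * Y₄ * d (3 ℕ.+ m) - μ′ m * (ζ m k * Y₄)) * s k
      ≈⟨ *-congʳ (+-cong (*-congʳ (*-congʳ (trans (*-congˡ (rise-snoc-offset 5 m k k≤m))
                                                   (*-congʳ (*-congʳ (c-pascal m k))))))
                         (-‿cong (*-congˡ shift))) ⟩
    ((a - b) * rise 1 (2 ℕ.+ k) * (R * Y₅) * Y₄ * d (3 ℕ.+ m)
       - μ′ m * (a * rise 1 (2 ℕ.+ k) * (Y (4 ℕ.+ (m ℕ.+ k)) * R))) * s k
      ≈⟨ *-congʳ (solve 10 (λ a b P R Y₅ Y₄ D t T z →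
           (a :- b) :* P :* (R :* Y₅) :* Y₄ :* D :- t :* z :* Y₅ :* (a :* P :* (T :* R))
           := (P :* R :* Y₅) :* ((a :- b) :* Y₄ :* D :- t :* z :* a :* T)) refl a b _ _ Y₅ Y₄ _ _ _ _) ⟩
    (G * ((a - b) * Y₄ * d (3 ℕ.+ m) - fromℕ 2 * fromℕ (suc m) * a * Y (4 ℕ.+ (m ℕ.+ k)))) * s k
      ≈⟨ trans (*-assoc _ _ _) (*-congˡ (*-inverse-sum d₁≉0 d₂≉0
           (trans (*-congˡ (sym (Y-odd k))) (ζ-identity m k)))) ⟩
    G * (fromℕ 2 * (a * Y (3 ℕ.+ k) - b * Y (4 ℕ.+ (m ℕ.+ k))))
      ≈⟨ solve 8 (λ P R Y₅ t a b S T → P :* R :* Y₅ :* (t :* (a :* S :- b :* T))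
                   := t :* (a :* (P :* S) :* (R :* Y₅) :- b :* P :* R :* T :* Y₅)) refl _ _ _ _ a b _ _ ⟩
    fromℕ 2 * (a * (rise 1 (2 ℕ.+ k) * Y (3 ℕ.+ k)) * (R * Y₅) - b * rise 1 (2 ℕ.+ k) * R * Y (4 ℕ.+ (m ℕ.+ k)) * Y₅)
      ≈⟨ *-congˡ (+-cong (*-cong (*-congˡ (sym (rising-snoc y 1 (2 ℕ.+ k)))) (sym (rise-snoc-offset 5 m k k≤m)))
                         (-‿cong (sym (previous k k≤m)))) ⟩
    fromℕ 2 * ∇ (η m) k ∎
    where
    a b R G Y₄ Y₅ : Carrier
    a = c m k
    b = prev (c m) k
    R = rise (5 ℕ.+ (m ℕ.+ k)) (m ∸ k)
    Y₄ = Y (4 ℕ.+ (m ℕ.+ m))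
    Y₅ = Y (5 ℕ.+ (m ℕ.+ m))
    G = rise 1 (2 ℕ.+ k) * R * Y₅
    shift : ζ m k * Y₄ ≈ a * rise 1 (2 ℕ.+ k) * (Y (4 ℕ.+ (m ℕ.+ k)) * R)
    shift = trans (*-assoc _ _ _) (*-congˡ (trans (*-congˡ (Y-≡ (≡.sym (b+[m+k]+[m∸k]≡b+[m+m] 4 m k k≤m))))
                                                  (rise-shift (4 ℕ.+ (m ℕ.+ k)) (m ∸ k))))
    previous : ∀ k → k ≤ m → prev (η m) k
                             ≈ prev (c m) k * rise 1 (2 ℕ.+ k) * rise (5 ℕ.+ (m ℕ.+ k)) (m ∸ k) * Y (4 ℕ.+ (m ℕ.+ k)) * Y₅
    previous zero    _   = solve 4 (λ P R Z W → con (+ 0) := con (+ 0) :* P :* R :* Z :* W) refl _ _ _ _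
    previous (suc j) j<m = begin
      c m j * rise 1 (3 ℕ.+ j) * rise (5 ℕ.+ (m ℕ.+ j)) (suc m ∸ j)
        ≈⟨ *-congˡ (reflexive (≡.cong (rise (5 ℕ.+ (m ℕ.+ j))) (ℕ.+-∸-assoc 1 (ℕ.<⇒≤ j<m)))) ⟩
      c m j * rise 1 (3 ℕ.+ j) * (Y (5 ℕ.+ (m ℕ.+ j)) * rise (6 ℕ.+ (m ℕ.+ j)) (m ∸ j))
        ≈⟨ *-congˡ (*-cong (Y-≡ e₄) (trans (reflexive (≡.cong (λ b → rise b (m ∸ j)) e₅))
                                           (rise-snoc-offset 5 m (suc j) j<m))) ⟩
      c m j * rise 1 (3 ℕ.+ j) * (Y (4 ℕ.+ (m ℕ.+ suc j)) * (rise (5 ℕ.+ (m ℕ.+ suc j)) (m ∸ suc j) * Y₅))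
        ≈⟨ solve 5 (λ a P Z R W → a :* P :* (Z :* (R :* W)) := a :* P :* R :* Z :* W) refl _ _ _ _ _ ⟩
      c m j * rise 1 (3 ℕ.+ j) * rise (5 ℕ.+ (m ℕ.+ suc j)) (m ∸ suc j) * Y (4 ℕ.+ (m ℕ.+ suc j)) * Y₅ ∎
      where
      e₄ : 5 ℕ.+ (m ℕ.+ j) ≡ 4 ℕ.+ (m ℕ.+ suc j)
      e₄ = ≡.cong (4 ℕ.+_) (≡.sym (ℕ.+-suc m j))
      e₅ : 6 ℕ.+ (m ℕ.+ j) ≡ 5 ℕ.+ (m ℕ.+ suc j)
      e₅ = ≡.cong (5 ℕ.+_) (≡.sym (ℕ.+-suc m j))
  ... | inj₂ ≡.refl = begin
    Y₄ * (ζ (suc m) (suc m) * d (3 ℕ.+ m) - μ′ m * ζ m (suc m)) * s (suc m)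
      ≈⟨ *-congʳ (*-congˡ (+-cong (*-congʳ (*-cong (*-congʳ (c-diagonal m)) (reflexive (≡.cong (rise _) (ℕ.n∸n≡0 m)))))
                                  (-‿cong (*-congˡ (c-top m _ _))))) ⟩
    Y₄ * (- c m m * A * 1# * d (3 ℕ.+ m) - μ′ m * 0#) * s (suc m)
      ≈⟨ *-congʳ (solve 5 (λ Y a P D t → Y :* ((:- a) :* P :* con (+ 1) :* D :- t :* con (+ 0))
                                         := (:- a) :* P :* (Y :* D)) refl _ _ _ _ _) ⟩
    (- c m m * A) * (Y₄ * d (3 ℕ.+ m)) * s (suc m)
      ≈⟨ trans (*-assoc _ _ _) (*-congˡ (*-inverse-sum d₁≉0 d₂≉0 edge)) ⟩
    (- c m m * A) * (fromℕ 2 * Y₅)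
      ≈⟨ solve 4 (λ a P t Y → (:- a) :* P :* (t :* Y) := t :* (con (+ 0) :- a :* P :* (Y :* con (+ 1)))) refl _ _ _ _ ⟩
    fromℕ 2 * (0# - c m m * A * (Y₅ * 1#))
      ≈⟨ *-congˡ (sym (+-cong (c-top m _ _) (-‿cong (*-congˡ (reflexive (≡.cong (rise _) (ℕ.m+n∸n≡m 1 m))))))) ⟩
    fromℕ 2 * ∇ (η m) (suc m) ∎
    where
    A Y₄ Y₅ : Carrier
    A = rise 1 (3 ℕ.+ m)
    Y₄ = Y (4 ℕ.+ (m ℕ.+ m))
    Y₅ = Y (5 ℕ.+ (m ℕ.+ m))
    edge : Y₄ * d (3 ℕ.+ m) * (d (2 ℕ.+ m) + d (3 ℕ.+ m)) ≈ fromℕ 2 * Y₅ * d (2 ℕ.+ m) * d (3 ℕ.+ m)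
    edge = begin
      Y₄ * d (3 ℕ.+ m) * (d (2 ℕ.+ m) + d (3 ℕ.+ m))
        ≈⟨ *-congʳ (*-congʳ (Y-+ 4 m m)) ⟩
      (y + (fromℕ 4 + (fromℕ m + fromℕ m))) * d (3 ℕ.+ m) * (d (2 ℕ.+ m) + d (3 ℕ.+ m))
        ≈⟨ solve 2 (λ x μ → (con (+ 2) :* x :+ (con (+ 4) :+ (μ :+ μ)))
                              :* (x :+ (con (+ 1) :+ (con (+ 1) :+ (con (+ 1) :+ μ))))
                              :* ((x :+ (con (+ 1) :+ (con (+ 1) :+ μ))) :+ (x :+ (con (+ 1) :+ (con (+ 1) :+ (con (+ 1) :+ μ)))))
                            := con (+ 2) :* (con (+ 2) :* x :+ (con (+ 5) :+ (μ :+ μ)))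
                              :* (x :+ (con (+ 1) :+ (con (+ 1) :+ μ))) :* (x :+ (con (+ 1) :+ (con (+ 1) :+ (con (+ 1) :+ μ)))))
             refl x (fromℕ m) ⟩
      fromℕ 2 * (y + (fromℕ 5 + (fromℕ m + fromℕ m))) * d (2 ℕ.+ m) * d (3 ℕ.+ m)
        ≈⟨ *-congʳ (*-congʳ (*-congˡ (sym (Y-+ 5 m m)))) ⟩
      fromℕ 2 * Y₅ * d (2 ℕ.+ m) * d (3 ℕ.+ m) ∎

  W-recurrence : ∀ m → Admissible (3 ℕ.+ m) → W (suc m) * d (3 ℕ.+ m) ≈ μ′ m * W m
  W-recurrence m adm = *-difference-≈0 Y₄≉0 (begin
    Y₄ * (W (suc m) * d (3 ℕ.+ m) - μ′ m * W m)
      ≈⟨ solve 4 (λ Y A D B → Y :* (A :* D :- B) := (Y :* D) :* A :- Y :* B) refl Y₄ _ _ _ ⟩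
    Y₄ * d (3 ℕ.+ m) * W (suc m) - Y₄ * (μ′ m * W m)
      ≈⟨ +-congˡ (-‿cong (trans (*-congˡ (*-congˡ (sym (sumTo-extend m _ ζvanishes)))) (sym (*-assoc _ _ _)))) ⟩
    Y₄ * d (3 ℕ.+ m) * W (suc m) - Y₄ * μ′ m * sumTo F (suc m) (λ k → ζ m k * s k)
      ≈⟨ sym (sumTo-linear (suc m) _ _ _ _) ⟩
    sumTo F (suc m) (λ k → Y₄ * d (3 ℕ.+ m) * (ζ (suc m) k * s k) - Y₄ * μ′ m * (ζ m k * s k))
      ≈⟨ sumTo-cong (suc m) (λ k k≤ → trans
           (solve 6 (λ Y D l Z z v → Y :* D :* (Z :* v) :- Y :* l :* (z :* v) := Y :* (Z :* D :- l :* z) :* v)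
                  refl _ _ _ _ _ _)
           (ζ-telescopes m k k≤ (adm k (ℕ.s≤s (ℕ.m≤n⇒m≤1+n k≤))) (adm (suc k) (ℕ.s≤s (ℕ.s≤s k≤))))) ⟩
    sumTo F (suc m) (λ k → fromℕ 2 * ∇ (η m) k)
      ≈⟨ trans (sym (sumTo-*ˡ (suc m) _ _)) (*-congˡ (sumTo-∇ (suc m) (η m))) ⟩
    fromℕ 2 * η m (suc m)
      ≈⟨ trans (*-congˡ (c-top m _ _)) (zeroʳ _) ⟩
    0# ∎)
    where
    Y₄ : Carrier
    Y₄ = Y (4 ℕ.+ (m ℕ.+ m))
    Y₄≉0 : Y₄ ≉ 0#
    Y₄≉0 = ≉0-resp-≈ (sym (Y-even m)) (*-≉0 (charZero 1) (adm (suc m) (ℕ.s≤s (ℕ.s≤s (ℕ.n≤1+n m)))))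
    ζvanishes : ζ m (suc m) * s (suc m) ≈ 0#
    ζvanishes = ≈0⇒*≈0 _ (c-top m _ _)

  -- Closed forms

  W-closed : ∀ m → Admissible (2 ℕ.+ m) →
             W m * (P (suc m) * P (suc m)) * d (2 ℕ.+ m) ≈ fact F m * d 1 * rise 1 (3 ℕ.+ (m ℕ.+ m))
  W-closed zero    adm = begin
    W 0 * (P 1 * P 1) * d 2
      ≈⟨ solve 4 (λ Z v P D → Z :* v :* (P :* P) :* D := Z :* (P :* P) :* D :* v) refl _ (s 0) _ _ ⟩
    ζ 0 0 * (P 1 * P 1) * d 2 * (u 1 + u 2)
      ≈⟨ *-inverse-sum (adm 0 (ℕ.s≤s ℕ.z≤n)) (adm 1 (ℕ.s≤s (ℕ.s≤s ℕ.z≤n)))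
           (solve 1 (λ x → con (+ 1) :* (con (+ 1) :+ con (+ 0))
                            :* ((con (+ 2) :* x :+ (con (+ 1) :+ con (+ 0))) :* ((con (+ 2) :* x :+ con (+ 2)) :* con (+ 1)))
                            :* con (+ 1)
                            :* ((x :+ (con (+ 1) :+ con (+ 0))) :* con (+ 1) :* ((x :+ (con (+ 1) :+ con (+ 0))) :* con (+ 1)))
                            :* (x :+ con (+ 2))
                            :* ((x :+ (con (+ 1) :+ con (+ 0))) :+ (x :+ con (+ 2)))
                          := con (+ 1) :* (x :+ (con (+ 1) :+ con (+ 0)))
                            :* ((con (+ 2) :* x :+ (con (+ 1) :+ con (+ 0)))
                                :* ((con (+ 2) :* x :+ con (+ 2)) :* ((con (+ 2) :* x :+ con (+ 3)) :* con (+ 1))))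
                            :* (x :+ (con (+ 1) :+ con (+ 0))) :* (x :+ con (+ 2)))
                  refl x) ⟩
    fact F 0 * d 1 * rise 1 3 ∎
  W-closed (suc m) adm = begin
    W (suc m) * (P (2 ℕ.+ m) * P (2 ℕ.+ m)) * d (3 ℕ.+ m)
      ≈⟨ solve 3 (λ A Q D → A :* Q :* D := A :* D :* Q) refl _ _ _ ⟩
    W (suc m) * d (3 ℕ.+ m) * (P (2 ℕ.+ m) * P (2 ℕ.+ m))
      ≈⟨ *-cong (W-recurrence m adm) (*-cong (rising-snoc x 1 (suc m)) (rising-snoc x 1 (suc m))) ⟩
    μ′ m * W m * (P (suc m) * d (2 ℕ.+ m) * (P (suc m) * d (2 ℕ.+ m)))
      ≈⟨ solve 4 (λ l A Q D → l :* A :* (Q :* D :* (Q :* D)) := l :* D :* (A :* (Q :* Q) :* D))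
           refl (μ′ m) (W m) (P (suc m)) (d (2 ℕ.+ m)) ⟩
    μ′ m * d (2 ℕ.+ m) * (W m * (P (suc m) * P (suc m)) * d (2 ℕ.+ m))
      ≈⟨ *-congˡ (W-closed m (admissible-≤ (ℕ.n≤1+n _) adm)) ⟩
    μ′ m * d (2 ℕ.+ m) * (fact F m * d 1 * rise 1 (3 ℕ.+ (m ℕ.+ m)))
      ≈⟨ solve 6 (λ μ Y D f e R → con (+ 2) :* (con (+ 1) :+ μ) :* Y :* D :* (f :* e :* R)
                                  := (con (+ 1) :+ μ) :* f :* e :* (R :* (con (+ 2) :* D) :* Y))
           refl (fromℕ m) (Y (5 ℕ.+ (m ℕ.+ m))) (d (2 ℕ.+ m)) (fact F m) (d 1) (rise 1 (3 ℕ.+ (m ℕ.+ m))) ⟩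
    fact F (suc m) * d 1 * (rise 1 (3 ℕ.+ (m ℕ.+ m)) * (fromℕ 2 * d (2 ℕ.+ m)) * Y (5 ℕ.+ (m ℕ.+ m)))
      ≈⟨ *-congˡ (sym (trans (rise-double 3 m) (*-congʳ (*-congˡ (Y-even m))))) ⟩
    fact F (suc m) * d 1 * rise 1 (3 ℕ.+ (suc m ℕ.+ suc m)) ∎

  V-closed : ∀ m → Admissible (suc m) →
             fromℕ 2 * V m * (P (suc m) * P (suc m)) ≈ fact F m * rise 1 (2 ℕ.+ (m ℕ.+ m)) * (Hx (suc m) - H F m 0#)
  V-closed zero    adm = ≈-modulo (inverseʳ (d 1) (adm 0 (ℕ.s≤s ℕ.z≤n)))
    (solve 2 (λ x v → con (+ 2) :* (con (+ 1) :* (con (+ 1) :+ con (+ 0)) :* ((con (+ 2) :* x :+ (con (+ 1) :+ con (+ 0))) :* con (+ 1)) :* con (+ 1)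
                                     :* v :* (con (+ 0) :+ (con (+ 0) :+ v)))
                        :* ((x :+ (con (+ 1) :+ con (+ 0))) :* con (+ 1) :* ((x :+ (con (+ 1) :+ con (+ 0))) :* con (+ 1)))
                      := con (+ 1) :* ((con (+ 2) :* x :+ (con (+ 1) :+ con (+ 0))) :* ((con (+ 2) :* x :+ con (+ 2)) :* con (+ 1)))
                           :* ((con (+ 0) :+ v) :- con (+ 0))
                         :+ con (+ 2) :* (con (+ 2) :* x :+ (con (+ 1) :+ con (+ 0))) :* (x :+ (con (+ 1) :+ con (+ 0))) :* v
                           :* ((x :+ (con (+ 1) :+ con (+ 0))) :* v :- con (+ 1)))
           refl x (u 1))
  V-closed (suc m) adm = begin
    fromℕ 2 * V (suc m) * (P (2 ℕ.+ m) * P (2 ℕ.+ m))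
      ≈⟨ *-congˡ (*-cong (rising-snoc x 1 (suc m)) (rising-snoc x 1 (suc m))) ⟩
    fromℕ 2 * V (suc m) * (P (suc m) * D * (P (suc m) * D))
      ≈⟨ solve 4 (λ t A Q D → t :* A :* (Q :* D :* (Q :* D)) := t :* (A :* D) :* D :* (Q :* Q)) refl _ _ _ D ⟩
    fromℕ 2 * (V (suc m) * D) * D * (P (suc m) * P (suc m))
      ≈⟨ *-congʳ (*-congʳ (*-congˡ recurrence)) ⟩
    fromℕ 2 * (λ′ m * V m - W m) * D * (P (suc m) * P (suc m))
      ≈⟨ solve 6 (λ t l A B D Q → t :* (l :* A :- B) :* D :* (Q :* Q)
                                  := l :* D :* (t :* A :* (Q :* Q)) :- t :* (B :* (Q :* Q) :* D))
           refl _ _ _ _ D _ ⟩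
    λ′ m * D * (fromℕ 2 * V m * (P (suc m) * P (suc m))) - fromℕ 2 * (W m * (P (suc m) * P (suc m)) * D)
      ≈⟨ +-cong (*-congˡ (V-closed m (admissible-≤ (ℕ.n≤1+n _) adm)))
                (-‿cong (*-congˡ (trans (W-closed m adm) (*-congˡ (rising-snoc y 1 (2 ℕ.+ (m ℕ.+ m))))))) ⟩
    λ′ m * D * (fact F m * R₂ * (Hx (suc m) - H F m 0#)) - fromℕ 2 * (fact F m * d 1 * (R₂ * Y₃))
      ≈⟨ ≈-modulo (inverseʳ D (adm (suc m) ℕ.≤-refl))
           (≈-modulo (inverseʳ (0# + fromℕ (suc m)) (≉0-resp-≈ (sym (+-identityˡ _)) (charZero m)))
           (solve 9 (λ x μ f R Y h₁ h₀ v ι →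
              con (+ 2) :* (con (+ 1) :+ μ) :* Y :* (x :+ (con (+ 1) :+ (con (+ 1) :+ μ))) :* (f :* R :* (h₁ :- h₀))
                :- con (+ 2) :* (f :* (x :+ (con (+ 1) :+ con (+ 0))) :* (R :* Y))
              := (con (+ 1) :+ μ) :* f :* (R :* Y :* (con (+ 2) :* (x :+ (con (+ 1) :+ (con (+ 1) :+ μ)))))
                   :* ((h₁ :+ v) :- (h₀ :+ ι))
                 :+ (:- (con (+ 2) :* f :* R :* Y :* (con (+ 1) :+ μ))) :* ((x :+ (con (+ 1) :+ (con (+ 1) :+ μ))) :* v :- con (+ 1))
                 :+ con (+ 2) :* f :* R :* Y :* (x :+ (con (+ 1) :+ (con (+ 1) :+ μ)))
                   :* ((con (+ 0) :+ (con (+ 1) :+ μ)) :* ι :- con (+ 1)))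
              refl x (fromℕ m) (fact F m) R₂ Y₃ (Hx (suc m)) (H F m 0#) (u (2 ℕ.+ m)) ((0# + fromℕ (suc m)) ⁻¹))) ⟩
    fact F (suc m) * (R₂ * Y₃ * (fromℕ 2 * D)) * (Hx (2 ℕ.+ m) - H F (suc m) 0#)
      ≈⟨ *-congʳ (*-congˡ (sym (trans (rise-double 2 m) (*-congˡ (Y-even m))))) ⟩
    fact F (suc m) * rise 1 (2 ℕ.+ (suc m ℕ.+ suc m)) * (Hx (2 ℕ.+ m) - H F (suc m) 0#) ∎
    where
    D R₂ Y₃ : Carrier
    D = d (2 ℕ.+ m)
    R₂ = rise 1 (2 ℕ.+ (m ℕ.+ m))
    Y₃ = Y (3 ℕ.+ (m ℕ.+ m))
    recurrence : V (suc m) * D ≈ λ′ m * V m - W m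
    recurrence = trans (solve 2 (λ A B → A := (A :- B) :+ B) refl _ (λ′ m * V m))
                       (trans (+-congʳ (V-recurrence m adm)) (+-comm _ _))

  -- Clearing the denominators of the theorem

  1+y+t≈Y : ∀ t → 1# + y + fromℕ t ≈ Y (suc t)
  1+y+t≈Y t = solve 2 (λ y t → con (+ 1) :+ y :+ t := y :+ (con (+ 1) :+ t)) refl y (fromℕ t)

  summand : ℕ → ℕ → Carrier
  summand n k = sgn F k * fromℕ (n C k)
                * _÷_ F (binom F (fromℕ 2 * x + fromℕ k) k) (binom F (fromℕ 2 * x + fromℕ (n ℕ.+ k)) k)
                * _÷_ F (1# + fromℕ 2 * x + fromℕ (2 ℕ.* k)) (1# + fromℕ 2 * x + fromℕ (n ℕ.+ k))
                * (Hx k * Hx k)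

  summand-cleared : ∀ n k → k ≤ n → binom F (y + fromℕ (n ℕ.+ k)) k ≉ 0# → 1# + y + fromℕ (n ℕ.+ k) ≉ 0# →
                    summand n k * rise (suc n) (suc n) ≈ weight n k * (Hx k * Hx k)
  summand-cleared n k k≤n B≉0 O≉0 = begin
    summand n k * rise (suc n) (suc n)
      ≈⟨ *-congˡ (trans (reflexive (≡.cong (rise (suc n)) (≡.sym length))) (rising-+ y (suc n) k (suc (n ∸ k)))) ⟩
    summand n k * (rise (suc n) k * (Y (suc (n ℕ.+ k)) * R))
      ≈⟨ solve 7 (λ a q o h P Z R → a :* q :* o :* h :* (P :* (Z :* R)) := a :* (q :* P) :* (o :* Z) :* R :* h)
           refl (c n k) _ _ _ _ _ R ⟩
    c n k * (Bk * Bnk ⁻¹ * rise (suc n) k) * (Ok * Onk ⁻¹ * Y (suc (n ℕ.+ k))) * R * (Hx k * Hx k)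
      ≈⟨ *-congʳ (*-congʳ (*-cong (*-congˡ binomials) odd)) ⟩
    weight n k * (Hx k * Hx k) ∎
    where
    Bk Bnk Ok Onk R : Carrier
    Bk = binom F (y + fromℕ k) k
    Bnk = binom F (y + fromℕ (n ℕ.+ k)) k
    Ok = 1# + y + fromℕ (2 ℕ.* k)
    Onk = 1# + y + fromℕ (n ℕ.+ k)
    R = rise (2 ℕ.+ (n ℕ.+ k)) (n ∸ k)
    length : k ℕ.+ suc (n ∸ k) ≡ suc n
    length = ≡.trans (ℕ.+-suc k (n ∸ k)) (≡.cong suc (ℕ.m+[n∸m]≡n k≤n))
    binomials : Bk * Bnk ⁻¹ * rise (suc n) k ≈ rise 1 k
    binomials = begin
      Bk * Bnk ⁻¹ * rise (suc n) k          ≈⟨ *-congˡ (sym (binom-rising y n k)) ⟩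
      Bk * Bnk ⁻¹ * (Bnk * fact F k)        ≈⟨ solve 4 (λ a v b f → a :* v :* (b :* f) := a :* f :* (v :* b)) refl _ _ _ _ ⟩
      Bk * fact F k * (Bnk ⁻¹ * Bnk)        ≈⟨ *-cong (binom-rising y 0 k) (inverseˡ Bnk B≉0) ⟩
      rise 1 k * 1#                         ≈⟨ *-identityʳ _ ⟩
      rise 1 k                              ∎
    odd : Ok * Onk ⁻¹ * Y (suc (n ℕ.+ k)) ≈ Y (suc (k ℕ.+ k))
    odd = begin
      Ok * Onk ⁻¹ * Y (suc (n ℕ.+ k))  ≈⟨ *-congˡ (sym (1+y+t≈Y (n ℕ.+ k))) ⟩
      Ok * Onk ⁻¹ * Onk                ≈⟨ ÷-*-cancel Ok O≉0 ⟩
      Ok                               ≈⟨ +-congˡ (fromℕ-cong (≡.cong (k ℕ.+_) (ℕ.+-identityʳ k))) ⟩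
      1# + y + fromℕ (k ℕ.+ k)         ≈⟨ 1+y+t≈Y (k ℕ.+ k) ⟩
      Y (suc (k ℕ.+ k))                ∎

  rhs-cleared : ∀ m → Admissible (suc m) → binom F (x + fromℕ (suc m)) (suc m) ≉ 0# →
    (fromℕ (2 ℕ.* suc m)) ⁻¹
      * _÷_ F (binom F (y + fromℕ (suc m)) (suc m))
              (binom F (x + fromℕ (suc m)) (suc m) * binom F (x + fromℕ (suc m)) (suc m))
      * (H F m 0# - Hx (suc m))
      * rise (2 ℕ.+ m) (2 ℕ.+ m)
    ≈ - (Y (3 ℕ.+ (m ℕ.+ m)) * V m)
  rhs-cleared m adm Bx≉0 = *-cancelʳ T T≉0 (begin
    i ⁻¹ * (By * (Bx * Bx) ⁻¹) * (h - Hx n) * Q * (i * (P n * P n))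
      ≈⟨ *-congˡ (*-congˡ (*-cong Pn Pn)) ⟩
    i ⁻¹ * (By * (Bx * Bx) ⁻¹) * (h - Hx n) * Q * (i * (Bx * fact F n * (Bx * fact F n)))
      ≈⟨ solve 8 (λ j i b w B f δ Q → j :* (b :* w) :* δ :* Q :* (i :* (B :* f :* (B :* f)))
                                     := (j :* i) :* (b :* f) :* (w :* (B :* B)) :* f :* δ :* Q)
           refl (i ⁻¹) i By ((Bx * Bx) ⁻¹) Bx (fact F n) _ Q ⟩
    i ⁻¹ * i * (By * fact F n) * ((Bx * Bx) ⁻¹ * (Bx * Bx)) * fact F n * (h - Hx n) * Q
      ≈⟨ *-congʳ (*-congʳ (*-congʳ (*-cong (*-cong (inverseˡ i i≉0) (binom-rising y 0 n))
                                           (inverseˡ (Bx * Bx) (*-≉0 Bx≉0 Bx≉0))))) ⟩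
    1# * rise 1 n * 1# * fact F n * (h - Hx n) * Q
      ≈⟨ solve 4 (λ R f δ Q → con (+ 1) :* R :* con (+ 1) :* f :* δ :* Q := (R :* Q) :* f :* δ)
           refl (rise 1 n) (fact F n) (h - Hx n) Q ⟩
    rise 1 n * Q * fact F n * (h - Hx n)
      ≈⟨ *-congʳ (*-congʳ (trans (sym (rising-+ y 1 n (suc n)))
                                  (trans (reflexive (≡.cong (rise 1) length)) (rising-snoc y 1 (2 ℕ.+ (m ℕ.+ m)))))) ⟩
    R₂ * Y₃ * fact F n * (h - Hx n)
      ≈⟨ solve 6 (λ R Y μ f h H → R :* Y :* ((con (+ 1) :+ μ) :* f) :* (h :- H)
                               := (:- (Y :* (con (+ 1) :+ μ))) :* (f :* R :* (H :- h))) refl R₂ Y₃ (fromℕ m) (fact F m) h (Hx n) ⟩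
    - (Y₃ * fromℕ n) * (fact F m * R₂ * (Hx n - h))
      ≈⟨ *-congˡ (sym (V-closed m adm)) ⟩
    - (Y₃ * fromℕ n) * (fromℕ 2 * V m * (P n * P n))
      ≈⟨ solve 5 (λ Y ν t A Q → (:- (Y :* ν)) :* (t :* A :* Q) := (:- (Y :* A)) :* (t :* ν :* Q)) refl Y₃ _ _ (V m) _ ⟩
    - (Y₃ * V m) * (fromℕ 2 * fromℕ n * (P n * P n))
      ≈⟨ *-congˡ (*-congʳ (sym (fromℕ-* 2 n))) ⟩
    - (Y₃ * V m) * (i * (P n * P n)) ∎)
    where
    n : ℕ
    n = suc m
    Bx By i h Q R₂ Y₃ T : Carrier
    Bx = binom F (x + fromℕ n) n
    By = binom F (y + fromℕ n) n
    i = fromℕ (2 ℕ.* n)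
    h = H F m 0#
    Q = rise (suc n) (suc n)
    R₂ = rise 1 (2 ℕ.+ (m ℕ.+ m))
    Y₃ = Y (3 ℕ.+ (m ℕ.+ m))
    T = i * (P n * P n)
    i≉0 : i ≉ 0#
    i≉0 = charZero (m ℕ.+ suc (m ℕ.+ 0))
    Pn : P n ≈ Bx * fact F n
    Pn = sym (binom-rising x 0 n)
    T≉0 : T ≉ 0#
    T≉0 = *-≉0 i≉0 (*-≉0 Pn≉0 Pn≉0)
      where
      Pn≉0 : P n ≉ 0#
      Pn≉0 = ≉0-resp-≈ (sym Pn) (*-≉0 Bx≉0 (fact-≉0 n))
    length : n ℕ.+ suc n ≡ suc (2 ℕ.+ (m ℕ.+ m))
    length = ≡.cong suc (≡.trans (ℕ.+-suc m (suc m)) (≡.cong suc (ℕ.+-suc m m)))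

  rise-≉0 : ∀ n → (∀ k → k ≤ n → 1# + y + fromℕ (n ℕ.+ k) ≉ 0#) → rise (suc n) (suc n) ≉ 0#
  rise-≉0 n factor =
    rising-≉0 y (suc n) (suc n) (λ k k<1+n → ≉0-resp-≈ (1+y+t≈Y (n ℕ.+ k)) (factor k (ℕ.≤-pred k<1+n)))

theorem7 : ∀ {c ℓ} (F : CharZeroField c ℓ) →
    let open CharZeroField F in
    (n : ℕ) → 1 ≤ n → (x : Carrier) →
    -- all expressions are defined: every denominator is nonzero
    (∀ (j : ℕ) → 1 ≤ j → j ≤ n → ¬ (x + fromℕ j ≈ 0#)) →
    (∀ (k : ℕ) → k ≤ n → ¬ (binom F (fromℕ 2 * x + fromℕ (n ℕ.+ k)) k ≈ 0#)) →
    (∀ (k : ℕ) → k ≤ n → ¬ (1# + fromℕ 2 * x + fromℕ (n ℕ.+ k) ≈ 0#)) →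
    ¬ (binom F (x + fromℕ n) n ≈ 0#) →
    sumTo F n (λ k →
        sgn F k * fromℕ (n C k)
        * _÷_ F (binom F (fromℕ 2 * x + fromℕ k) k)
                (binom F (fromℕ 2 * x + fromℕ (n ℕ.+ k)) k)
        * _÷_ F (1# + fromℕ 2 * x + fromℕ (2 ℕ.* k))
                (1# + fromℕ 2 * x + fromℕ (n ℕ.+ k))
        * (H F k x * H F k x))
    ≈ (fromℕ (2 ℕ.* n)) ⁻¹
      * _÷_ F (binom F (fromℕ 2 * x + fromℕ n) n)
              (binom F (x + fromℕ n) n * binom F (x + fromℕ n) n)
      * (H F (n ∸ 1) 0# - H F n x)
theorem7 F (suc m) _ x x+j≉0 B≉0 O≉0 Bx≉0 =
  *-cancelʳ (rise (2 ℕ.+ m) (2 ℕ.+ m)) (rise-≉0 (suc m) O≉0) (begin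
    sumTo F (suc m) (summand (suc m)) * rise (2 ℕ.+ m) (2 ℕ.+ m)
      ≈⟨ sumTo-*ʳ (suc m) (summand (suc m)) _ ⟩
    sumTo F (suc m) (λ k → summand (suc m) k * rise (2 ℕ.+ m) (2 ℕ.+ m))
      ≈⟨ sumTo-cong (suc m) (λ k k≤n → summand-cleared (suc m) k k≤n (B≉0 k k≤n) (O≉0 k k≤n)) ⟩
    sumTo F (suc m) (λ k → weight (suc m) k * (Hx k * Hx k))
      ≈⟨ abel-summation m ⟩
    - (Y (3 ℕ.+ (m ℕ.+ m)) * V m)
      ≈⟨ sym (rhs-cleared m (λ j j<n → x+j≉0 (suc j) (ℕ.s≤s ℕ.z≤n) j<n) Bx≉0) ⟩
    _ ∎)
  where
  open CharZeroField F
  open FieldLemmas F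
  open Sums F
  open Development F x
  open import Relation.Binary.Reasoning.Setoid setoid
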